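{- If $G$ is an $8$-minimal graph with maximum degree at most $3$, then $G$ is $3$-regular.
   Context: All graphs are finite and simple. The square $G^2$ of $G$ has vertex set $V(G)$, with two vertices adjacent if their distance in $G$ is at most $2$. A graph is $k$-choosable if it admits a proper coloring from any assignment of lists of size $k$. A graph $G$ is $k$-minimal if $G^2$ is not $k$-choosable but $H^2$ is $k$-choosable for every proper subgraph $H$ of $G$. -}

module Defs where

open import Data.Nat using (ℕ; _≤_)
open import Data.Bool using (Bool; true; false; if_then_else_)
open import Data.Fin using (Fin)
open import Data.List using (List; length; map; allFin)
open import Data.Nat.ListAction using (sum)
open import Data.List.Membership.Propositional using (_∈_)
open import Data.List.Relation.Unary.Unique.Propositional using (Unique)
open import Data.Product using (Σ; ∃; _×_)
open import Data.Sum using (_⊎_)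
open import Function.Definitions using (Injective)
open import Relation.Binary.PropositionalEquality using (_≡_; _≢_)
open import Relation.Nullary using (¬_)

record Graph : Set where
  field
    n      : ℕ
    adj    : Fin n → Fin n → Bool
    sym    : ∀ u v → adj u v ≡ adj v u
    irrefl : ∀ v → adj v v ≡ false
open Graph public

Adj : (G : Graph) → Fin (n G) → Fin (n G) → Set
Adj G u v = adj G u v ≡ true

Adj² : (G : Graph) → Fin (n G) → Fin (n G) → Set
Adj² G u v = u ≢ v × (Adj G u v ⊎ ∃ λ w → Adj G u w × Adj G w v)

degree : (G : Graph) → Fin (n G) → ℕ
degree G v = sum (map (λ w → if adj G v w then 1 else 0) (allFin (n G)))

MaxDegreeAtMost : ℕ → Graph → Set
MaxDegreeAtMost d G = ∀ v → degree G v ≤ d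

Regular : ℕ → Graph → Set
Regular d G = ∀ v → degree G v ≡ d

SquareChoosable : ℕ → Graph → Set
SquareChoosable k G =
  (L : Fin (n G) → List ℕ) →
  (∀ v → length (L v) ≡ k) → (∀ v → Unique (L v)) →
  ∃ λ (c : Fin (n G) → ℕ) →
    (∀ v → c v ∈ L v) × (∀ u v → Adj² G u v → c u ≢ c v)

record Subgraph (H G : Graph) : Set where
  field
    emb      : Fin (n H) → Fin (n G)
    emb-inj  : Injective _≡_ _≡_ emb
    emb-adj  : ∀ u v → Adj H u v → Adj G (emb u) (emb v)
open Subgraph public

Proper : {H G : Graph} → Subgraph H G → Set
Proper {H} {G} s =
  (∃ λ (w : Fin (n G)) → ∀ u → emb s u ≢ w)
  ⊎ (∃ λ u → ∃ λ v → Adj G (emb s u) (emb s v) × ¬ Adj H u v)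

record Minimal (k : ℕ) (G : Graph) : Set₁ where
  field
    not-choosable : ¬ SquareChoosable k G
    proper-sub-choosable :
      (H : Graph) (s : Subgraph H G) → Proper s → SquareChoosable k H

-- Suppose a vertex v has degree at most 2 and colour (G − v)² from the lists, by
-- minimality. Two vertices adjacent in G² but not in (G − v)² are both neighbours
-- of v, so the colouring becomes proper on G² once v and one neighbour u of v are
-- uncoloured. In G², u sees at most 3 + 3 + 2 − 1 = 7 vertices other than v, and
-- v sees at most 2 · 3 = 6, so u and then v can be recoloured greedily from lists
-- of size 8, making G² 8-choosable: a contradiction.
module Submission where

open import Defs hiding (sym)
open import Data.Bool using (Bool; true; false; if_then_else_) renaming (_≟_ to _≟ᵇ_)
open import Data.Empty using (⊥-elim)
open import Data.Fin using (Fin; punchIn; punchOut) renaming (_≟_ to _≟ᶠ_)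
open import Data.Fin.Properties using (punchInᵢ≢i; punchIn-injective; punchIn-punchOut)
open import Data.List using (List; []; _∷_; length; map; concatMap; filter; allFin)
open import Data.List.Properties using (length-++; length-map; length-filter; filter-notAll)
open import Data.List.Membership.Propositional using (_∈_; _∉_; find; lose)
open import Data.List.Membership.Propositional.Properties
  using (∈-allFin; ∈-map⁺; ∈-filter⁺; ∈-filter⁻; ∈-concatMap⁺)
open import Data.List.Relation.Binary.Subset.Propositional using (_⊆_)
open import Data.List.Relation.Unary.All using () renaming (lookup to All-lookup)
open import Data.List.Relation.Unary.AllPairs using ([]; _∷_)
open import Data.List.Relation.Unary.Any using (Any; here; there; any?)
open import Data.List.Relation.Unary.Unique.Propositional using (Unique)
open import Data.Nat using (ℕ; zero; suc; _+_; _*_; _≤_; _<_; z≤n; s≤s)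
open import Data.Nat.ListAction using (sum)
open import Data.Nat.Properties
  using (≤-trans; ≤-reflexive; m≤n⇒m≤1+n; <⇒≱; ≤-pred; ≤∧≢⇒<; +-mono-≤; +-assoc; *-monoˡ-≤;
         +-commutativeSemigroup; module ≤-Reasoning)
  renaming (_≟_ to _≟ℕ_)
open import Algebra.Properties.CommutativeSemigroup +-commutativeSemigroup using (x∙yz≈y∙xz)
open import Data.Product using (∃; _×_; _,_; proj₁; proj₂; map₂)
open import Data.Sum using (inj₁; inj₂)
open import Function using (_∘_)
open import Function.Definitions using (Injective)
open import Relation.Binary.Definitions using (DecidableEquality)
open import Relation.Binary.PropositionalEquality
  using (_≡_; _≢_; refl; sym; trans; cong; subst; subst₂)
open import Relation.Nullary using (¬_; yes; no)
open import Relation.Nullary.Decidable using (¬?; decidable-stable)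

module _ {a} {A : Set a} (_≟_ : DecidableEquality A) where
  open import Data.List.Membership.DecPropositional _≟_ using (_∈?_; _∉?_)

  unique-⊆⇒length≤ : {xs ys : List A} → Unique xs → xs ⊆ ys → length xs ≤ length ys
  unique-⊆⇒length≤ [] _ = z≤n
  unique-⊆⇒length≤ {x ∷ xs} {ys} (x∉xs ∷ unique) x∷xs⊆ys = begin-strict
    length xs                          ≤⟨ unique-⊆⇒length≤ unique xs⊆ys-x ⟩
    length (filter (¬? ∘ (x ≟_)) ys)   <⟨ filter-notAll (¬? ∘ (x ≟_)) ys x∈ys ⟩
    length ys                          ∎
    where
    open ≤-Reasoning
    xs⊆ys-x : xs ⊆ filter (¬? ∘ (x ≟_)) ys
    xs⊆ys-x z∈xs = ∈-filter⁺ (¬? ∘ (x ≟_)) (x∷xs⊆ys (there z∈xs)) (All-lookup x∉xs z∈xs)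
    x∈ys : Any (λ y → ¬ x ≢ y) ys
    x∈ys = lose (x∷xs⊆ys (here refl)) (λ x≢x → x≢x refl)

  unique-∃∉ : {xs ys : List A} → Unique xs → length ys < length xs → ∃ λ x → x ∈ xs × x ∉ ys
  unique-∃∉ {xs} {ys} unique ys<xs with any? (_∉? ys) xs
  ... | yes some∉ = find some∉
  ... | no none∉ = ⊥-elim (<⇒≱ ys<xs (unique-⊆⇒length≤ unique xs⊆ys))
    where
    xs⊆ys : xs ⊆ ys
    xs⊆ys {x} x∈xs = decidable-stable (x ∈? ys) (none∉ ∘ lose x∈xs)

module _ {a b} {A : Set a} {B : Set b} where

  length-concatMap : (f : A → List B) (xs : List A) →
                     length (concatMap f xs) ≡ sum (map (length ∘ f) xs)
  length-concatMap f [] = refl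
  length-concatMap f (x ∷ xs) =
    trans (length-++ (f x)) (cong (length (f x) +_) (length-concatMap f xs))

module _ {a} {A : Set a} where

  length≤1-∈⇒≡ : {xs : List A} {x y : A} → length xs ≤ 1 → x ∈ xs → y ∈ xs → x ≡ y
  length≤1-∈⇒≡ {_ ∷ []} _ (here refl) (here refl) = refl
  length≤1-∈⇒≡ {_ ∷ _ ∷ _} (s≤s ()) _ _

  sum-map-mono : (f g : A → ℕ) (xs : List A) → (∀ {x} → x ∈ xs → f x ≤ g x) →
                 sum (map f xs) ≤ sum (map g xs)
  sum-map-mono f g [] _ = z≤n
  sum-map-mono f g (x ∷ xs) f≤g = +-mono-≤ (f≤g (here refl)) (sum-map-mono f g xs (f≤g ∘ there))

  sum-map-≤-length* : (f : A → ℕ) (b : ℕ) (xs : List A) → (∀ {x} → x ∈ xs → f x ≤ b) →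
                      sum (map f xs) ≤ length xs * b
  sum-map-≤-length* f b [] _ = z≤n
  sum-map-≤-length* f b (x ∷ xs) f≤b =
    +-mono-≤ (f≤b (here refl)) (sum-map-≤-length* f b xs (f≤b ∘ there))

  +-sum-map-≤-length* : (f : A → ℕ) (b d : ℕ) {x : A} {xs : List A} → x ∈ xs → d + f x ≤ b →
                        (∀ {y} → y ∈ xs → f y ≤ b) → d + sum (map f xs) ≤ length xs * b
  +-sum-map-≤-length* f b d {xs = x ∷ xs} (here refl) d+fx≤b f≤b = begin
    d + (f x + sum (map f xs))  ≡⟨ +-assoc d (f x) _ ⟨
    d + f x + sum (map f xs)    ≤⟨ +-mono-≤ d+fx≤b (sum-map-≤-length* f b xs (f≤b ∘ there)) ⟩
    b + length xs * b           ∎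
    where open ≤-Reasoning
  +-sum-map-≤-length* f b d {xs = y ∷ xs} (there x∈xs) d+fx≤b f≤b = begin
    d + (f y + sum (map f xs))  ≡⟨ x∙yz≈y∙xz d (f y) _ ⟩
    f y + (d + sum (map f xs))  ≤⟨ +-mono-≤ (f≤b (here refl))
                                     (+-sum-map-≤-length* f b d x∈xs d+fx≤b (f≤b ∘ there)) ⟩
    b + length xs * b           ∎
    where open ≤-Reasoning

  sum-map-indicator : (p : A → Bool) (xs : List A) →
                      sum (map (λ x → if p x then 1 else 0) xs) ≡
                      length (filter (λ x → p x ≟ᵇ true) xs)
  sum-map-indicator p [] = refl
  sum-map-indicator p (x ∷ xs) with p x
  ... | true = cong suc (sum-map-indicator p xs)
  ... | false = sum-map-indicator p xs

SquareListColouring : (G : Graph) → (Fin (n G) → List ℕ) → (Fin (n G) → ℕ) → Set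
SquareListColouring G L c = (∀ v → c v ∈ L v) × (∀ u v → Adj² G u v → c u ≢ c v)

module _ (G : Graph) where
  private
    V : Set
    V = Fin (n G)
  open import Data.List.Membership.DecPropositional (_≟ᶠ_ {n G}) using (_∉?_)

  neighbours : V → List V
  neighbours x = filter (λ y → adj G x y ≟ᵇ true) (allFin (n G))

  ∈-neighbours⁺ : ∀ {x y} → Adj G x y → y ∈ neighbours x
  ∈-neighbours⁺ {x} {y} xy = ∈-filter⁺ (λ y → adj G x y ≟ᵇ true) (∈-allFin y) xy

  ∈-neighbours⁻ : ∀ {x y} → y ∈ neighbours x → Adj G x y
  ∈-neighbours⁻ {x} y∈ = proj₂ (∈-filter⁻ (λ y → adj G x y ≟ᵇ true) {xs = allFin (n G)} y∈)

  degree≡length-neighbours : ∀ x → degree G x ≡ length (neighbours x)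
  degree≡length-neighbours x = sum-map-indicator (adj G x) (allFin (n G))

  Adj-sym : ∀ {x y} → Adj G x y → Adj G y x
  Adj-sym {x} {y} = trans (Graph.sym G y x)

  Adj⇒≢ : ∀ {x y} → Adj G x y → x ≢ y
  Adj⇒≢ {x} xx refl with () ← trans (sym xx) (irrefl G x)

  Adj²-sym : ∀ {x y} → Adj² G x y → Adj² G y x
  Adj²-sym (x≢y , inj₁ xy) = x≢y ∘ sym , inj₁ (Adj-sym xy)
  Adj²-sym (x≢y , inj₂ (w , xw , wy)) = x≢y ∘ sym , inj₂ (w , Adj-sym wy , Adj-sym xw)

  neighboursExcept : V → V → List V
  neighboursExcept x y = filter (¬? ∘ (x ≟ᶠ_)) (neighbours y)

  neighbours-∉-≡ : ∀ {v u rest D} → degree G v ≤ 2 → neighbours v ≡ u ∷ rest → u ∈ D →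
                   ∀ {x y} → x ∉ D → y ∉ D → Adj G v x → Adj G v y → x ≡ y
  neighbours-∉-≡ {v} {u} {rest} {D} deg≤2 eq u∈D x∉D y∉D vx vy =
    length≤1-∈⇒≡ |rest|≤1 (∈rest x∉D vx) (∈rest y∉D vy)
    where
    |rest|≤1 : length rest ≤ 1
    |rest|≤1 = ≤-pred (subst (_≤ 2) (trans (degree≡length-neighbours v) (cong length eq)) deg≤2)
    ∈rest : ∀ {x} → x ∉ D → Adj G v x → x ∈ rest
    ∈rest {x} x∉D vx with subst (x ∈_) eq (∈-neighbours⁺ vx)
    ... | here refl = ⊥-elim (x∉D u∈D)
    ... | there x∈rest = x∈rest

  -- Lists every vertex at distance 1 or 2 from x, possibly with repetitions.
  neighbours² : V → List V
  neighbours² x = concatMap (λ y → y ∷ neighboursExcept x y) (neighbours x)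

  ∈-neighbours²⁺ : ∀ {x w} → Adj² G x w → w ∈ neighbours² x
  ∈-neighbours²⁺ {x} (_ , inj₁ xw) =
    ∈-concatMap⁺ (λ y → y ∷ neighboursExcept x y) (lose (∈-neighbours⁺ xw) (here refl))
  ∈-neighbours²⁺ {x} (x≢w , inj₂ (y , xy , yw)) =
    ∈-concatMap⁺ (λ y → y ∷ neighboursExcept x y)
      (lose (∈-neighbours⁺ xy) (there (∈-filter⁺ (¬? ∘ (x ≟ᶠ_)) (∈-neighbours⁺ yw) x≢w)))

  length-neighbours²≤ : ∀ x → length (neighbours² x) ≤ sum (map (degree G) (neighbours x))
  length-neighbours²≤ x = begin
    length (neighbours² x)                            ≡⟨ length-concatMap _ (neighbours x) ⟩
    sum (map (suc ∘ length ∘ others) (neighbours x))  ≤⟨ sum-map-mono _ _ _ others<degree ⟩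
    sum (map (degree G) (neighbours x))               ∎
    where
    open ≤-Reasoning
    others = neighboursExcept x
    others<degree : ∀ {y} → y ∈ neighbours x → suc (length (others y)) ≤ degree G y
    others<degree {y} y∈ = ≤-trans
      (filter-notAll (¬? ∘ (x ≟ᶠ_)) (neighbours y)
        (lose (∈-neighbours⁺ (Adj-sym (∈-neighbours⁻ y∈))) (λ x≢x → x≢x refl)))
      (≤-reflexive (sym (degree≡length-neighbours y)))

  record ColouringAwayFrom (L : V → List ℕ) (D : List V) (c : V → ℕ) : Set where
    field
      from-lists : ∀ {w} → w ∉ D → c w ∈ L w
      proper     : ∀ {x y} → x ∉ D → y ∉ D → Adj² G x y → c x ≢ c y

  colouringAwayFrom-[] : ∀ {L c} → ColouringAwayFrom L [] c → SquareListColouring G L c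
  colouringAwayFrom-[] col = (λ w → from-lists λ ()) , (λ x y → proper (λ ()) (λ ()))
    where open ColouringAwayFrom col

  extend : (L : V → List ℕ) {D : List V} {c : V → ℕ} (x : V) → Unique (L x) →
           length (filter (_∉? D) (neighbours² x)) < length (L x) →
           ColouringAwayFrom L (x ∷ D) c → ∃ (ColouringAwayFrom L D)
  extend L {D} {c} x unique few col =
    recoloured , record { from-lists = from-lists′ ; proper = proper′ }
    where
    open ColouringAwayFrom col
    used : List ℕ
    used = map c (filter (_∉? D) (neighbours² x))
    fresh : ∃ λ k → k ∈ L x × k ∉ used
    fresh = unique-∃∉ _≟ℕ_ unique
      (subst (_< length (L x)) (sym (length-map c (filter (_∉? D) (neighbours² x)))) few)
    k : ℕ
    k = proj₁ fresh
    k∈L : k ∈ L x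
    k∈L = proj₁ (proj₂ fresh)
    k∉used : k ∉ used
    k∉used = proj₂ (proj₂ fresh)

    recoloured : V → ℕ
    recoloured w with w ≟ᶠ x
    ... | yes _ = k
    ... | no _ = c w

    ∉-∷ : ∀ {w} → w ≢ x → w ∉ D → w ∉ x ∷ D
    ∉-∷ w≢x w∉D (here w≡x) = w≢x w≡x
    ∉-∷ w≢x w∉D (there w∈D) = w∉D w∈D

    used-∋ : ∀ {w} → w ∉ D → Adj² G x w → c w ∈ used
    used-∋ w∉D xw = ∈-map⁺ c (∈-filter⁺ (_∉? D) (∈-neighbours²⁺ xw) w∉D)

    from-lists′ : ∀ {w} → w ∉ D → recoloured w ∈ L w
    from-lists′ {w} w∉D with w ≟ᶠ x
    ... | yes refl = k∈L
    ... | no w≢x = from-lists (∉-∷ w≢x w∉D)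

    proper′ : ∀ {y z} → y ∉ D → z ∉ D → Adj² G y z → recoloured y ≢ recoloured z
    proper′ {y} {z} y∉D z∉D yz with y ≟ᶠ x | z ≟ᶠ x
    ... | yes refl | yes refl = ⊥-elim (proj₁ yz refl)
    ... | yes refl | no _ = λ k≡cz → k∉used (subst (_∈ used) (sym k≡cz) (used-∋ z∉D yz))
    ... | no _ | yes refl = λ cy≡k → k∉used (subst (_∈ used) cy≡k (used-∋ y∉D (Adj²-sym yz)))
    ... | no y≢x | no z≢x = proper (∉-∷ y≢x y∉D) (∉-∷ z≢x z∉D) yz

module _ (G : Graph) {m : ℕ} (f : Fin m → Fin (n G)) where

  induced : Graph
  induced = record
    { n      = m
    ; adj    = λ x y → adj G (f x) (f y)
    ; sym    = λ x y → Graph.sym G (f x) (f y)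
    ; irrefl = λ x → irrefl G (f x)
    }

  induced-subgraph : Injective _≡_ _≡_ f → Subgraph induced G
  induced-subgraph f-inj = record { emb = f ; emb-inj = f-inj ; emb-adj = λ _ _ xy → xy }

  module _ {v : Fin (n G)} (section : ∀ {w} → v ≢ w → Fin m)
           (f∘section : ∀ {w} (v≢w : v ≢ w) → f (section v≢w) ≡ w) where

    section-≢ : ∀ {x y} (v≢x : v ≢ x) (v≢y : v ≢ y) → x ≢ y → section v≢x ≢ section v≢y
    section-≢ v≢x v≢y x≢y eq = x≢y (trans (sym (f∘section v≢x)) (trans (cong f eq) (f∘section v≢y)))

    Adj-section : ∀ {x y} (v≢x : v ≢ x) (v≢y : v ≢ y) →
                  Adj G x y → Adj induced (section v≢x) (section v≢y)
    Adj-section v≢x v≢y = subst₂ (Adj G) (sym (f∘section v≢x)) (sym (f∘section v≢y))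

    Adj²-section : ∀ {x y} (v≢x : v ≢ x) (v≢y : v ≢ y) → ¬ (Adj G v x × Adj G v y) →
                   Adj² G x y → Adj² induced (section v≢x) (section v≢y)
    Adj²-section v≢x v≢y _ (x≢y , inj₁ xy) = section-≢ v≢x v≢y x≢y , inj₁ (Adj-section v≢x v≢y xy)
    Adj²-section v≢x v≢y notBoth (x≢y , inj₂ (w , xw , wy)) with v ≟ᶠ w
    ... | yes refl = ⊥-elim (notBoth (Adj-sym G xw , wy))
    ... | no v≢w = section-≢ v≢x v≢y x≢y ,
                   inj₂ (section v≢w , Adj-section v≢x v≢w xw , Adj-section v≢w v≢y wy)

    lift : (L : Fin (n G) → List ℕ) {D : List (Fin (n G))} → v ∈ D →
           (∀ {x y} → x ∉ D → y ∉ D → Adj G v x → Adj G v y → x ≡ y) →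
           ∃ (SquareListColouring induced (L ∘ f)) → ∃ (ColouringAwayFrom G L D)
    lift L {D} v∈D atMostOne (cH , cH∈L , cH-proper) =
      c , record { from-lists = from-lists ; proper = proper }
      where
      v≢ : ∀ {w} → w ∉ D → v ≢ w
      v≢ w∉D v≡w = w∉D (subst (_∈ D) v≡w v∈D)

      c : Fin (n G) → ℕ
      c w with v ≟ᶠ w
      ... | yes _ = 0  -- arbitrary: v ∈ D
      ... | no v≢w = cH (section v≢w)

      from-lists : ∀ {w} → w ∉ D → c w ∈ L w
      from-lists {w} w∉D with v ≟ᶠ w
      ... | yes v≡w = ⊥-elim (v≢ w∉D v≡w)
      ... | no v≢w = subst (λ u → cH (section v≢w) ∈ L u) (f∘section v≢w) (cH∈L (section v≢w))

      proper : ∀ {x y} → x ∉ D → y ∉ D → Adj² G x y → c x ≢ c y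
      proper {x} {y} x∉D y∉D xy with v ≟ᶠ x | v ≟ᶠ y
      ... | yes v≡x | _ = ⊥-elim (v≢ x∉D v≡x)
      ... | no _ | yes v≡y = ⊥-elim (v≢ y∉D v≡y)
      ... | no v≢x | no v≢y = cH-proper _ _ (Adj²-section v≢x v≢y notBoth xy)
        where
        notBoth : ¬ (Adj G v x × Adj G v y)
        notBoth (vx , vy) = proj₁ xy (atMostOne x∉D y∉D vx vy)

module _ (G : Graph) (subcubic : MaxDegreeAtMost 3 G) where
  private
    V : Set
    V = Fin (n G)
  open import Data.List.Membership.DecPropositional (_≟ᶠ_ {n G}) using (_∉?_)

  length-neighbours≤ : ∀ {x d} → degree G x ≤ d → length (neighbours G x) ≤ d
  length-neighbours≤ {x} {d} = subst (_≤ d) (degree≡length-neighbours G x)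

  length-neighbours²≤6 : ∀ {v} → degree G v ≤ 2 → length (neighbours² G v) ≤ 6
  length-neighbours²≤6 {v} deg≤2 = begin
    length (neighbours² G v)               ≤⟨ length-neighbours²≤ G v ⟩
    sum (map (degree G) (neighbours G v))  ≤⟨ sum-map-≤-length* (degree G) 3 (neighbours G v)
                                                 (λ _ → subcubic _) ⟩
    length (neighbours G v) * 3            ≤⟨ *-monoˡ-≤ 3 (length-neighbours≤ deg≤2) ⟩
    6                                      ∎
    where open ≤-Reasoning

  length-neighbours²≤8 : ∀ {u v} → Adj G u v → degree G v ≤ 2 → length (neighbours² G u) ≤ 8
  length-neighbours²≤8 {u} uv deg≤2 = ≤-pred (begin-strict
    length (neighbours² G u)               ≤⟨ length-neighbours²≤ G u ⟩
    sum (map (degree G) (neighbours G u))  <⟨ +-sum-map-≤-length* (degree G) 3 1 (∈-neighbours⁺ G uv)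
                                                 (s≤s deg≤2) (λ _ → subcubic _) ⟩
    length (neighbours G u) * 3            ≤⟨ *-monoˡ-≤ 3 (length-neighbours≤ (subcubic u)) ⟩
    9                                      ∎)
    where open ≤-Reasoning

  squareChoosable-deletion : ∀ {m} {f : Fin m → V} {v : V} (section : ∀ {w} → v ≢ w → Fin m) →
                             (∀ {w} (v≢w : v ≢ w) → f (section v≢w) ≡ w) →
                             degree G v ≤ 2 → SquareChoosable 8 (induced G f) → SquareChoosable 8 G
  squareChoosable-deletion {f = f} {v} section f∘section deg≤2 choosable L |L|≡8 unique =
    map₂ (colouringAwayFrom-[] G) (colour (neighbours G v) refl)
    where
    colouringH : ∃ (SquareListColouring (induced G f) (L ∘ f))
    colouringH = choosable (L ∘ f) (|L|≡8 ∘ f) (unique ∘ f)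

    fits : ∀ w {k} → k ≤ 7 → k < length (L w)
    fits w k≤7 = subst (_ <_) (sym (|L|≡8 w)) (s≤s k≤7)

    extend-v : ∀ {c} → ColouringAwayFrom G L (v ∷ []) c → ∃ (ColouringAwayFrom G L [])
    extend-v = extend G L v (unique v) (fits v
      (≤-trans (length-filter (_∉? []) (neighbours² G v)) (m≤n⇒m≤1+n (length-neighbours²≤6 deg≤2))))

    colour : ∀ ns → neighbours G v ≡ ns → ∃ (ColouringAwayFrom G L [])
    colour [] eq =
      extend-v (proj₂ (lift G f section f∘section L (here refl) noNeighbours colouringH))
      where
      noNeighbours : ∀ {x y} → x ∉ v ∷ [] → y ∉ v ∷ [] → Adj G v x → Adj G v y → x ≡ y
      noNeighbours _ _ vx _ with () ← subst (_ ∈_) eq (∈-neighbours⁺ G vx)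
    colour (u ∷ rest) eq =
      extend-v (proj₂ (extend G L u (unique u) u-few
        (proj₂ (lift G f section f∘section L (there (here refl))
          (neighbours-∉-≡ G deg≤2 eq (here refl)) colouringH))))
      where
      uv : Adj G u v
      uv = Adj-sym G (∈-neighbours⁻ G (subst (u ∈_) (sym eq) (here refl)))
      v∈neighbours²u : v ∈ neighbours² G u
      v∈neighbours²u = ∈-neighbours²⁺ G (Adj⇒≢ G uv , inj₁ uv)
      u-few : length (filter (_∉? v ∷ []) (neighbours² G u)) < length (L u)
      u-few = fits u (≤-pred (≤-trans
        (filter-notAll (_∉? v ∷ []) (neighbours² G u) (lose v∈neighbours²u (λ v∉ → v∉ (here refl))))
        (length-neighbours²≤8 uv deg≤2)))

lemma5 : (G : Graph) → Minimal 8 G → MaxDegreeAtMost 3 G → Regular 3 G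
lemma5 record { n = zero } _ _ ()
lemma5 G@record { n = suc _ } minimal subcubic v with degree G v ≟ℕ 3
... | yes deg≡3 = deg≡3
... | no deg≢3 = ⊥-elim (not-choosable
      (squareChoosable-deletion G subcubic punchOut punchIn-punchOut deg≤2 G-v-choosable))
  where
  open Minimal minimal
  deg≤2 : degree G v ≤ 2
  deg≤2 = ≤-pred (≤∧≢⇒< (subcubic v) deg≢3)
  G-v-choosable : SquareChoosable 8 (induced G (punchIn v))
  G-v-choosable = proper-sub-choosable _ (induced-subgraph G (punchIn v) (punchIn-injective v _ _))
                                         (inj₁ (v , punchInᵢ≢i v))
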